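{- For every $w\in\mathfrak{H}$, $\partial_1(w)=w\diamond y-wy$.
   Context: Let $\mathfrak{H}=\mathbb{Q}\langle x,y\rangle$ be the noncommutative polynomial algebra in $x,y$, and set $z=x+y$. $\partial_1$ is the $\mathbb{Q}$-linear derivation of $\mathfrak{H}$ with $\partial_1(x)=yx$ and $\partial_1(y)=-yx$. The harmonic product $*$ on $\mathfrak{H}$ is the $\mathbb{Q}$-bilinear product defined recursively by $1*w=w*1=w$, $xw_1*w_2=w_1*xw_2=x(w_1*w_2)$, and $yw_1*yw_2=y(w_1*yw_2)+y(yw_1*w_2)+yx(w_1*w_2)$. Let $\phi$ be the algebra automorphism of $\mathfrak{H}$ with $\phi(x)=z$, $\phi(y)=-y$. Define $w_1\diamond w_2=\phi(\phi(w_1)*\phi(w_2))$. -}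

module Defs where

open import Data.Bool using (Bool; true; false; _∧_; if_then_else_)
open import Data.List using (List; []; _∷_; _++_; map; concatMap)
open import Data.Product using (_×_; _,_)
open import Data.Rational using (ℚ; 0ℚ; 1ℚ; _+_; _*_; -_)
open import Relation.Binary.PropositionalEquality using (_≡_)

-- An element is represented by a finite formal ℚ-linear combination of
-- words (a list of (coefficient , word) pairs); two representations are
-- identified when every word has the same total coefficient (_≈_).

data Letter : Set where
  x y : Letter

Word : Set
Word = List Letter

_==ᴸ_ : Letter → Letter → Bool
x ==ᴸ x = true
y ==ᴸ y = true
_ ==ᴸ _ = false

_==ᵂ_ : Word → Word → Bool
[] ==ᵂ [] = true
(a ∷ u) ==ᵂ (b ∷ v) = (a ==ᴸ b) ∧ (u ==ᵂ v)
_ ==ᵂ _ = false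

H : Set
H = List (ℚ × Word)

coeff : H → Word → ℚ
coeff [] w = 0ℚ
coeff ((c , u) ∷ p) w = (if u ==ᵂ w then c else 0ℚ) + coeff p w

_≈_ : H → H → Set
p ≈ q = ∀ w → coeff p w ≡ coeff q w

infix 4 _≈_

word : Word → H
word u = (1ℚ , u) ∷ []

𝟎 : H
𝟎 = []

_⊕_ : H → H → H
p ⊕ q = p ++ q

infixl 6 _⊕_ _⊖_

scale : ℚ → H → H
scale c p = map (λ { (d , u) → (c * d , u) }) p

neg : H → H
neg = scale (- 1ℚ)

_⊖_ : H → H → H
p ⊖ q = p ⊕ neg q

bilin : (Word → Word → H) → H → H → H
bilin f p q = concatMap (λ { (c , u) → concatMap (λ { (d , v) → scale (c * d) (f u v) }) q }) p

lin : (Word → H) → H → H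
lin f p = concatMap (λ { (c , u) → scale c (f u) }) p

_·_ : H → H → H
_·_ = bilin (λ u v → word (u ++ v))

infixl 7 _·_

pre : Word → H → H
pre u p = map (λ { (c , v) → (c , u ++ v) }) p

∂₁-letter : Letter → H
∂₁-letter x = word (y ∷ x ∷ [])
∂₁-letter y = neg (word (y ∷ x ∷ []))

∂₁-word : Word → H
∂₁-word [] = 𝟎
∂₁-word (a ∷ u) = (∂₁-letter a · word u) ⊕ pre (a ∷ []) (∂₁-word u)

∂₁ : H → H
∂₁ = lin ∂₁-word

harm-word : Word → Word → H
harm-word [] v = word v
harm-word (x ∷ u) v = pre (x ∷ []) (harm-word u v)
harm-word (y ∷ u) [] = word (y ∷ u)
harm-word (y ∷ u) (x ∷ v) = pre (x ∷ []) (harm-word (y ∷ u) v)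
harm-word (y ∷ u) (y ∷ v) =
  pre (y ∷ []) (harm-word u (y ∷ v))
  ⊕ pre (y ∷ []) (harm-word (y ∷ u) v)
  ⊕ pre (y ∷ x ∷ []) (harm-word u v)

_✱_ : H → H → H
_✱_ = bilin harm-word

infixl 7 _✱_

φ-letter : Letter → H
φ-letter x = word (x ∷ []) ⊕ word (y ∷ [])
φ-letter y = neg (word (y ∷ []))

φ-word : Word → H
φ-word [] = word []
φ-word (a ∷ u) = φ-letter a · φ-word u

φ : H → H
φ = lin φ-word

_◇_ : H → H → H
p ◇ q = φ (φ p ✱ φ q)

infixl 7 _◇_

𝕪 : H
𝕪 = word (y ∷ [])

{-# OPTIONS --safe #-}
module Submission where

-- Both sides are linear in w, so it suffices to compare them on words. Put
-- ψ q = φ (q ✱ φ y), so that w ◇ y = ψ (φ w). The recursion for ✱ together with φ x = z,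
-- φ y = -y gives ψ (x q) = z ψ q and ψ (y q) = -y ψ q + y x φ q; the latter because
-- (y u) ✱ y = y (u ✱ y + z u) and φ z = x. As φ is an involution, induction on the
-- word u then gives ψ (φ u) = ∂₁ u + u y.

open import Defs
open import Data.Bool using (true; false; if_then_else_)
open import Data.List using ([]; _∷_; _++_; concatMap; length)
open import Data.List.Properties
  using (++-assoc; ++-identityʳ; map-++; map-concatMap; concatMap-cong; concatMap-++)
open import Data.Nat using (suc; _≤_; z≤n; s≤s)
open import Data.Nat.Properties using (≤-refl; ≤-trans; m≤n⇒m≤1+n)
open import Data.Product using (_,_)
open import Data.Rational using (ℚ; 0ℚ; 1ℚ; _+_; _*_; -_)
open import Data.Rational.Properties
  using (+-identityˡ; +-identityʳ; +-assoc; +-comm; *-identityˡ; *-identityʳ; *-zeroˡ; *-zeroʳ;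
         *-assoc; *-distribˡ-+)
open import Data.Rational.Solver using (module +-*-Solver)
open import Relation.Binary.Bundles using (Setoid)
open import Relation.Binary.PropositionalEquality
  using (_≡_; refl; sym; trans; cong; cong₂; subst; module ≡-Reasoning)
import Relation.Binary.Reasoning.Setoid as SetoidReasoning

open +-*-Solver using (solve; con; _:+_; _:*_; _:=_)

==ᵂ-refl : ∀ u → (u ==ᵂ u) ≡ true
==ᵂ-refl [] = refl
==ᵂ-refl (x ∷ u) = ==ᵂ-refl u
==ᵂ-refl (y ∷ u) = ==ᵂ-refl u

==ᵂ-sound : ∀ u v → (u ==ᵂ v) ≡ true → u ≡ v
==ᵂ-sound [] [] _ = refl
==ᵂ-sound (x ∷ u) (x ∷ v) e = cong (x ∷_) (==ᵂ-sound u v e)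
==ᵂ-sound (y ∷ u) (y ∷ v) e = cong (y ∷_) (==ᵂ-sound u v e)

-- _≈_ unfolds to a Π-type, so Agda cannot infer its endpoints from a goal; _≋_ is the same
-- relation wrapped in a record.
record _≋_ (p q : H) : Set where
  constructor coeffwise
  field at : ∀ w → coeff p w ≡ coeff q w

open _≋_

infix 4 _≋_

≋-setoid : Setoid _ _
≋-setoid = record
  { Carrier = H
  ; _≈_ = _≋_
  ; isEquivalence = record
    { refl = coeffwise λ _ → refl
    ; sym = λ p≋q → coeffwise λ w → sym (at p≋q w)
    ; trans = λ p≋q q≋r → coeffwise λ w → trans (at p≋q w) (at q≋r w)
    }
  }

open Setoid ≋-setoid
  using () renaming (refl to ≋-refl; sym to ≋-sym; trans to ≋-trans; reflexive to ≋-reflexive)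

module ≋-Reasoning = SetoidReasoning ≋-setoid

coeff-⊕ : ∀ p q w → coeff (p ⊕ q) w ≡ coeff p w + coeff q w
coeff-⊕ [] q w = sym (+-identityˡ _)
coeff-⊕ ((c , u) ∷ p) q w =
  trans (cong (cᵤ +_) (coeff-⊕ p q w)) (sym (+-assoc cᵤ (coeff p w) (coeff q w)))
  where cᵤ = if u ==ᵂ w then c else 0ℚ

coeff-scale : ∀ c p w → coeff (scale c p) w ≡ c * coeff p w
coeff-scale c [] w = sym (*-zeroʳ c)
coeff-scale c ((d , u) ∷ p) w =
  trans (cong₂ _+_ (entry (u ==ᵂ w)) (coeff-scale c p w)) (sym (*-distribˡ-+ c _ _))
  where
  entry : ∀ b → (if b then c * d else 0ℚ) ≡ c * (if b then d else 0ℚ)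
  entry true = refl
  entry false = sym (*-zeroʳ c)

⊕-cong : ∀ {p p′ q q′} → p ≋ p′ → q ≋ q′ → p ⊕ q ≋ p′ ⊕ q′
⊕-cong {p} {p′} {q} {q′} p≋p′ q≋q′ = coeffwise λ w →
  trans (coeff-⊕ p q w) (trans (cong₂ _+_ (at p≋p′ w) (at q≋q′ w)) (sym (coeff-⊕ p′ q′ w)))

scale-cong : ∀ c {p q} → p ≋ q → scale c p ≋ scale c q
scale-cong c {p} {q} p≋q = coeffwise λ w →
  trans (coeff-scale c p w) (trans (cong (c *_) (at p≋q w)) (sym (coeff-scale c q w)))

⊕-assoc : ∀ p q r → (p ⊕ q) ⊕ r ≡ p ⊕ (q ⊕ r)
⊕-assoc = ++-assoc

scale-⊕ : ∀ c p q → scale c (p ⊕ q) ≡ scale c p ⊕ scale c q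
scale-⊕ c = map-++ _

⊕-comm : ∀ p q → p ⊕ q ≋ q ⊕ p
⊕-comm p q = coeffwise λ w →
  trans (coeff-⊕ p q w) (trans (+-comm (coeff p w) (coeff q w)) (sym (coeff-⊕ q p w)))

⊕-rotate : ∀ p q r → p ⊕ q ⊕ r ≋ r ⊕ p ⊕ q
⊕-rotate p q r = ≋-trans (⊕-comm (p ⊕ q) r) (≋-reflexive (sym (⊕-assoc r p q)))

⊕-⊖-cancelʳ : ∀ p q → p ⊕ q ⊖ q ≋ p
⊕-⊖-cancelʳ p q = coeffwise λ w → begin
  coeff (p ⊕ q ⊖ q) w
    ≡⟨ coeff-⊕ (p ⊕ q) (neg q) w ⟩
  coeff (p ⊕ q) w + coeff (neg q) w
    ≡⟨ cong₂ _+_ (coeff-⊕ p q w) (coeff-scale (- 1ℚ) q w) ⟩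
  (coeff p w + coeff q w) + - 1ℚ * coeff q w
    ≡⟨ solve 2 (λ a b → (a :+ b) :+ con (- 1ℚ) :* b := a) refl (coeff p w) (coeff q w) ⟩
  coeff p w   ∎
  where open ≡-Reasoning

neg-involutive : ∀ p → neg (neg p) ≋ p
neg-involutive p = coeffwise λ w →
  trans (coeff-scale (- 1ℚ) (neg p) w) (trans (cong (- 1ℚ *_) (coeff-scale (- 1ℚ) p w))
    (solve 1 (λ a → con (- 1ℚ) :* (con (- 1ℚ) :* a) := a) refl (coeff p w)))

≋⇒⊖≋𝟎 : ∀ {p q} → p ≋ q → p ⊖ q ≋ 𝟎
≋⇒⊖≋𝟎 {p} {q} p≋q = begin
  p ⊖ q   ≈⟨ ⊕-cong p≋q ≋-refl ⟩
  q ⊖ q   ≈⟨ ⊕-⊖-cancelʳ 𝟎 q ⟩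
  𝟎       ∎
  where open ≋-Reasoning

⟨_∣_⟩ : (Word → ℚ) → H → ℚ
⟨ g ∣ [] ⟩ = 0ℚ
⟨ g ∣ (c , u) ∷ p ⟩ = c * g u + ⟨ g ∣ p ⟩

δ : Word → Word → ℚ
δ w u = if u ==ᵂ w then 1ℚ else 0ℚ

coeff≡⟨δ∣⟩ : ∀ p w → coeff p w ≡ ⟨ δ w ∣ p ⟩
coeff≡⟨δ∣⟩ [] w = refl
coeff≡⟨δ∣⟩ ((c , u) ∷ p) w = cong₂ _+_ (entry (u ==ᵂ w)) (coeff≡⟨δ∣⟩ p w)
  where
  entry : ∀ b → (if b then c else 0ℚ) ≡ c * (if b then 1ℚ else 0ℚ)
  entry true = sym (*-identityʳ c)
  entry false = sym (*-zeroʳ c)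

⟨∣⟩-++ : ∀ g p q → ⟨ g ∣ p ++ q ⟩ ≡ ⟨ g ∣ p ⟩ + ⟨ g ∣ q ⟩
⟨∣⟩-++ g [] q = sym (+-identityˡ _)
⟨∣⟩-++ g ((c , u) ∷ p) q =
  trans (cong (c * g u +_) (⟨∣⟩-++ g p q)) (sym (+-assoc (c * g u) ⟨ g ∣ p ⟩ ⟨ g ∣ q ⟩))

⟨∣⟩-scale : ∀ g c p → ⟨ g ∣ scale c p ⟩ ≡ c * ⟨ g ∣ p ⟩
⟨∣⟩-scale g c [] = sym (*-zeroʳ c)
⟨∣⟩-scale g c ((d , u) ∷ p) =
  trans (cong₂ _+_ (*-assoc c d (g u)) (⟨∣⟩-scale g c p)) (sym (*-distribˡ-+ c (d * g u) ⟨ g ∣ p ⟩))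

⟨∣⟩-word : ∀ g u → ⟨ g ∣ word u ⟩ ≡ g u
⟨∣⟩-word g u = trans (+-identityʳ (1ℚ * g u)) (*-identityˡ (g u))

⟨∣⟩-cong : ∀ {g h} p → (∀ u → g u ≡ h u) → ⟨ g ∣ p ⟩ ≡ ⟨ h ∣ p ⟩
⟨∣⟩-cong [] g≡h = refl
⟨∣⟩-cong ((c , u) ∷ p) g≡h = cong₂ _+_ (cong (c *_) (g≡h u)) (⟨∣⟩-cong p g≡h)

⟨∣⟩-+ : ∀ g h p → ⟨ (λ u → g u + h u) ∣ p ⟩ ≡ ⟨ g ∣ p ⟩ + ⟨ h ∣ p ⟩
⟨∣⟩-+ g h [] = sym (+-identityˡ 0ℚ)
⟨∣⟩-+ g h ((c , u) ∷ p) = trans (cong (c * (g u + h u) +_) (⟨∣⟩-+ g h p))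
  (solve 5 (λ c a b s t → c :* (a :+ b) :+ (s :+ t) := (c :* a :+ s) :+ (c :* b :+ t))
     refl c (g u) (h u) ⟨ g ∣ p ⟩ ⟨ h ∣ p ⟩)

⟨∣⟩-* : ∀ c g p → ⟨ (λ u → c * g u) ∣ p ⟩ ≡ c * ⟨ g ∣ p ⟩
⟨∣⟩-* c g [] = sym (*-zeroʳ c)
⟨∣⟩-* c g ((d , u) ∷ p) = trans (cong (d * (c * g u) +_) (⟨∣⟩-* c g p))
  (solve 4 (λ c d a s → d :* (c :* a) :+ c :* s := c :* (d :* a :+ s)) refl c d (g u) ⟨ g ∣ p ⟩)

⟨∣⟩-lin : ∀ g F p → ⟨ g ∣ lin F p ⟩ ≡ ⟨ (λ u → ⟨ g ∣ F u ⟩) ∣ p ⟩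
⟨∣⟩-lin g F [] = refl
⟨∣⟩-lin g F ((c , u) ∷ p) = trans (⟨∣⟩-++ g (scale c (F u)) (lin F p))
  (cong₂ _+_ (⟨∣⟩-scale g c (F u)) (⟨∣⟩-lin g F p))

coeff-lin : ∀ F p w → coeff (lin F p) w ≡ ⟨ (λ u → coeff (F u) w) ∣ p ⟩
coeff-lin F p w = trans (coeff≡⟨δ∣⟩ (lin F p) w) (trans (⟨∣⟩-lin (δ w) F p)
  (⟨∣⟩-cong p (λ u → sym (coeff≡⟨δ∣⟩ (F u) w))))

drop : Word → H → H
drop u [] = []
drop u ((c , v) ∷ p) = if v ==ᵂ u then drop u p else (c , v) ∷ drop u p

⟨∣⟩-drop : ∀ g u p → ⟨ g ∣ p ⟩ ≡ coeff p u * g u + ⟨ g ∣ drop u p ⟩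
⟨∣⟩-drop g u [] = sym (trans (+-identityʳ _) (*-zeroˡ (g u)))
⟨∣⟩-drop g u ((c , v) ∷ p) with v ==ᵂ u in v==u
... | true rewrite ==ᵂ-sound v u v==u = trans (cong (c * g u +_) (⟨∣⟩-drop g u p))
  (solve 4 (λ c a k s → c :* k :+ (a :* k :+ s) := (c :+ a) :* k :+ s)
     refl c (coeff p u) (g u) ⟨ g ∣ drop u p ⟩)
... | false = trans (cong (c * g v +_) (⟨∣⟩-drop g u p))
  (solve 5 (λ c k a l s → c :* k :+ (a :* l :+ s) := (con 0ℚ :+ a) :* l :+ (c :* k :+ s))
     refl c (g v) (coeff p u) (g u) ⟨ g ∣ drop u p ⟩)

drop-head : ∀ u c p → drop u ((c , u) ∷ p) ≡ drop u p
drop-head u c p rewrite ==ᵂ-refl u = refl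

length-drop : ∀ u p → length (drop u p) ≤ length p
length-drop u [] = z≤n
length-drop u ((c , v) ∷ p) with v ==ᵂ u
... | true = m≤n⇒m≤1+n (length-drop u p)
... | false = s≤s (length-drop u p)

⟨∣⟩-drop-null : ∀ g u p → coeff p u ≡ 0ℚ → ⟨ g ∣ p ⟩ ≡ ⟨ g ∣ drop u p ⟩
⟨∣⟩-drop-null g u p p[u]≡0 = begin
  ⟨ g ∣ p ⟩                            ≡⟨ ⟨∣⟩-drop g u p ⟩
  coeff p u * g u + ⟨ g ∣ drop u p ⟩   ≡⟨ cong (λ a → a * g u + ⟨ g ∣ drop u p ⟩) p[u]≡0 ⟩
  0ℚ * g u + ⟨ g ∣ drop u p ⟩          ≡⟨ cong (_+ ⟨ g ∣ drop u p ⟩) (*-zeroˡ (g u)) ⟩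
  0ℚ + ⟨ g ∣ drop u p ⟩                ≡⟨ +-identityˡ _ ⟩
  ⟨ g ∣ drop u p ⟩                     ∎
  where open ≡-Reasoning

drop-≋𝟎 : ∀ u {p} → p ≋ 𝟎 → drop u p ≋ 𝟎
drop-≋𝟎 u {p} p≋𝟎 = coeffwise λ w → begin
  coeff (drop u p) w   ≡⟨ coeff≡⟨δ∣⟩ (drop u p) w ⟩
  ⟨ δ w ∣ drop u p ⟩   ≡⟨ ⟨∣⟩-drop-null (δ w) u p (at p≋𝟎 u) ⟨
  ⟨ δ w ∣ p ⟩          ≡⟨ coeff≡⟨δ∣⟩ p w ⟨
  coeff p w            ≡⟨ at p≋𝟎 w ⟩
  0ℚ                   ∎
  where open ≡-Reasoning

-- By induction on the length: dropping every term on the first word of p leaves a shorter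
-- representative of 0.
⟨∣⟩-≋𝟎 : ∀ g n p → length p ≤ n → p ≋ 𝟎 → ⟨ g ∣ p ⟩ ≡ 0ℚ
⟨∣⟩-≋𝟎 g n [] _ _ = refl
⟨∣⟩-≋𝟎 g (suc n) p@((c , u) ∷ p′) (s≤s |p′|≤n) p≋𝟎 = begin
  ⟨ g ∣ p ⟩           ≡⟨ ⟨∣⟩-drop-null g u p (at p≋𝟎 u) ⟩
  ⟨ g ∣ drop u p ⟩    ≡⟨ cong ⟨ g ∣_⟩ (drop-head u c p′) ⟩
  ⟨ g ∣ drop u p′ ⟩   ≡⟨ ⟨∣⟩-≋𝟎 g n (drop u p′) |drop|≤n drop≋𝟎 ⟩
  0ℚ                  ∎
  where
  open ≡-Reasoning
  |drop|≤n : length (drop u p′) ≤ n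
  |drop|≤n = ≤-trans (length-drop u p′) |p′|≤n
  drop≋𝟎 : drop u p′ ≋ 𝟎
  drop≋𝟎 = subst (_≋ 𝟎) (drop-head u c p′) (drop-≋𝟎 u p≋𝟎)

⟨∣⟩-resp-≋ : ∀ g {p q} → p ≋ q → ⟨ g ∣ p ⟩ ≡ ⟨ g ∣ q ⟩
⟨∣⟩-resp-≋ g {p} {q} p≋q = begin
  ⟨ g ∣ p ⟩
    ≡⟨ solve 2 (λ a b → a := (a :+ con (- 1ℚ) :* b) :+ b) refl ⟨ g ∣ p ⟩ ⟨ g ∣ q ⟩ ⟩
  (⟨ g ∣ p ⟩ + - 1ℚ * ⟨ g ∣ q ⟩) + ⟨ g ∣ q ⟩
    ≡⟨ cong (λ a → (⟨ g ∣ p ⟩ + a) + ⟨ g ∣ q ⟩) (⟨∣⟩-scale g (- 1ℚ) q) ⟨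
  (⟨ g ∣ p ⟩ + ⟨ g ∣ neg q ⟩) + ⟨ g ∣ q ⟩
    ≡⟨ cong (_+ ⟨ g ∣ q ⟩) (⟨∣⟩-++ g p (neg q)) ⟨
  ⟨ g ∣ p ⊖ q ⟩ + ⟨ g ∣ q ⟩
    ≡⟨ cong (_+ ⟨ g ∣ q ⟩) (⟨∣⟩-≋𝟎 g _ (p ⊖ q) ≤-refl (≋⇒⊖≋𝟎 p≋q)) ⟩
  0ℚ + ⟨ g ∣ q ⟩
    ≡⟨ +-identityˡ _ ⟩
  ⟨ g ∣ q ⟩   ∎
  where open ≡-Reasoning

lin-cong : ∀ F {p q} → p ≋ q → lin F p ≋ lin F q
lin-cong F {p} {q} p≋q = coeffwise λ w → begin
  coeff (lin F p) w               ≡⟨ coeff-lin F p w ⟩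
  ⟨ (λ u → coeff (F u) w) ∣ p ⟩   ≡⟨ ⟨∣⟩-resp-≋ (λ u → coeff (F u) w) p≋q ⟩
  ⟨ (λ u → coeff (F u) w) ∣ q ⟩   ≡⟨ coeff-lin F q w ⟨
  coeff (lin F q) w               ∎
  where open ≡-Reasoning

lin-ext : ∀ {F G} → (∀ u → F u ≋ G u) → ∀ p → lin F p ≋ lin G p
lin-ext {F} {G} F≋G p = coeffwise λ w →
  trans (coeff-lin F p w) (trans (⟨∣⟩-cong p (λ u → at (F≋G u) w)) (sym (coeff-lin G p w)))

lin-word : ∀ F u → lin F (word u) ≋ F u
lin-word F u = coeffwise λ w → trans (coeff-lin F (word u) w) (⟨∣⟩-word (λ v → coeff (F v) w) u)

lin-⊕ : ∀ F p q → lin F (p ⊕ q) ≡ lin F p ⊕ lin F q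
lin-⊕ F = concatMap-++ _

lin-scale : ∀ F c p → lin F (scale c p) ≋ scale c (lin F p)
lin-scale F c p = coeffwise λ w → begin
  coeff (lin F (scale c p)) w             ≡⟨ coeff-lin F (scale c p) w ⟩
  ⟨ (λ u → coeff (F u) w) ∣ scale c p ⟩   ≡⟨ ⟨∣⟩-scale (λ u → coeff (F u) w) c p ⟩
  c * ⟨ (λ u → coeff (F u) w) ∣ p ⟩       ≡⟨ cong (c *_) (coeff-lin F p w) ⟨
  c * coeff (lin F p) w                   ≡⟨ coeff-scale c (lin F p) w ⟨
  coeff (scale c (lin F p)) w             ∎
  where open ≡-Reasoning

lin-lin : ∀ F K p → lin F (lin K p) ≋ lin (λ u → lin F (K u)) p
lin-lin F K p = coeffwise λ w → begin
  coeff (lin F (lin K p)) w                         ≡⟨ coeff-lin F (lin K p) w ⟩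
  ⟨ (λ u → coeff (F u) w) ∣ lin K p ⟩               ≡⟨ ⟨∣⟩-lin (λ u → coeff (F u) w) K p ⟩
  ⟨ (λ v → ⟨ (λ u → coeff (F u) w) ∣ K v ⟩) ∣ p ⟩   ≡⟨ ⟨∣⟩-cong p (λ v → coeff-lin F (K v) w) ⟨
  ⟨ (λ v → coeff (lin F (K v)) w) ∣ p ⟩             ≡⟨ coeff-lin (λ v → lin F (K v)) p w ⟨
  coeff (lin (λ u → lin F (K u)) p) w               ∎
  where open ≡-Reasoning

lin-pointwise-⊕ : ∀ F G p → lin (λ u → F u ⊕ G u) p ≋ lin F p ⊕ lin G p
lin-pointwise-⊕ F G p = coeffwise λ w → begin
  coeff (lin (λ u → F u ⊕ G u) p) w
    ≡⟨ coeff-lin (λ u → F u ⊕ G u) p w ⟩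
  ⟨ (λ u → coeff (F u ⊕ G u) w) ∣ p ⟩
    ≡⟨ ⟨∣⟩-cong p (λ u → coeff-⊕ (F u) (G u) w) ⟩
  ⟨ (λ u → coeff (F u) w + coeff (G u) w) ∣ p ⟩
    ≡⟨ ⟨∣⟩-+ (λ u → coeff (F u) w) (λ u → coeff (G u) w) p ⟩
  ⟨ (λ u → coeff (F u) w) ∣ p ⟩ + ⟨ (λ u → coeff (G u) w) ∣ p ⟩
    ≡⟨ cong₂ _+_ (coeff-lin F p w) (coeff-lin G p w) ⟨
  coeff (lin F p) w + coeff (lin G p) w
    ≡⟨ coeff-⊕ (lin F p) (lin G p) w ⟨
  coeff (lin F p ⊕ lin G p) w   ∎
  where open ≡-Reasoning

lin-pointwise-scale : ∀ c F p → lin (λ u → scale c (F u)) p ≋ scale c (lin F p)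
lin-pointwise-scale c F p = coeffwise λ w → begin
  coeff (lin (λ u → scale c (F u)) p) w     ≡⟨ coeff-lin (λ u → scale c (F u)) p w ⟩
  ⟨ (λ u → coeff (scale c (F u)) w) ∣ p ⟩   ≡⟨ ⟨∣⟩-cong p (λ u → coeff-scale c (F u) w) ⟩
  ⟨ (λ u → c * coeff (F u) w) ∣ p ⟩         ≡⟨ ⟨∣⟩-* c (λ u → coeff (F u) w) p ⟩
  c * ⟨ (λ u → coeff (F u) w) ∣ p ⟩         ≡⟨ cong (c *_) (coeff-lin F p w) ⟨
  c * coeff (lin F p) w                     ≡⟨ coeff-scale c (lin F p) w ⟨
  coeff (scale c (lin F p)) w               ∎
  where open ≡-Reasoning

Linear : (H → H) → Set
Linear M = ∀ p → M p ≋ lin (λ u → M (word u)) p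

lin-linear : ∀ F → Linear (lin F)
lin-linear F = lin-ext (λ u → ≋-sym (lin-word F u))

linear-resp-≋ : ∀ {M N} → (∀ p → M p ≋ N p) → Linear N → Linear M
linear-resp-≋ {M} {N} M≋N N-lin p = begin
  M p                        ≈⟨ M≋N p ⟩
  N p                        ≈⟨ N-lin p ⟩
  lin (λ u → N (word u)) p   ≈⟨ lin-ext (λ u → M≋N (word u)) p ⟨
  lin (λ u → M (word u)) p   ∎
  where open ≋-Reasoning

linear-unique : ∀ {M N} → Linear M → Linear N → (∀ u → M (word u) ≋ N (word u)) → ∀ p → M p ≋ N p
linear-unique {M} {N} M-lin N-lin agree p = begin
  M p                        ≈⟨ M-lin p ⟩
  lin (λ u → M (word u)) p   ≈⟨ lin-ext agree p ⟩
  lin (λ u → N (word u)) p   ≈⟨ N-lin p ⟨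
  N p                        ∎
  where open ≋-Reasoning

linear-cong : ∀ {M} → Linear M → ∀ {p q} → p ≋ q → M p ≋ M q
linear-cong {M} M-lin {p} {q} p≋q = begin
  M p                        ≈⟨ M-lin p ⟩
  lin (λ u → M (word u)) p   ≈⟨ lin-cong (λ u → M (word u)) p≋q ⟩
  lin (λ u → M (word u)) q   ≈⟨ M-lin q ⟨
  M q                        ∎
  where open ≋-Reasoning

linear-⊕ : ∀ {M} → Linear M → ∀ p q → M (p ⊕ q) ≋ M p ⊕ M q
linear-⊕ {M} M-lin p q = begin
  M (p ⊕ q)                        ≈⟨ M-lin (p ⊕ q) ⟩
  lin (λ u → M (word u)) (p ⊕ q)   ≡⟨ lin-⊕ (λ u → M (word u)) p q ⟩
  lin (λ u → M (word u)) p ⊕ lin (λ u → M (word u)) q ≈⟨ ⊕-cong (M-lin p) (M-lin q) ⟨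
  M p ⊕ M q   ∎
  where open ≋-Reasoning

linear-scale : ∀ {M} → Linear M → ∀ c p → M (scale c p) ≋ scale c (M p)
linear-scale {M} M-lin c p = begin
  M (scale c p)                        ≈⟨ M-lin (scale c p) ⟩
  lin (λ u → M (word u)) (scale c p)   ≈⟨ lin-scale (λ u → M (word u)) c p ⟩
  scale c (lin (λ u → M (word u)) p)   ≈⟨ scale-cong c (M-lin p) ⟨
  scale c (M p)                        ∎
  where open ≋-Reasoning

∘-linear : ∀ {M N} → Linear M → Linear N → Linear (λ p → M (N p))
∘-linear {M} {N} M-lin N-lin p = begin
  M (N p)                                             ≈⟨ linear-cong M-lin (N-lin p) ⟩
  M (lin (λ u → N (word u)) p)                        ≈⟨ M-lin _ ⟩
  lin (λ u → M (word u)) (lin (λ u → N (word u)) p)   ≈⟨ lin-lin (λ u → M (word u)) (λ u → N (word u)) p ⟩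
  lin (λ u → lin (λ v → M (word v)) (N (word u))) p   ≈⟨ lin-ext (λ u → M-lin (N (word u))) p ⟨
  lin (λ u → M (N (word u))) p                        ∎
  where open ≋-Reasoning

⊕-linear : ∀ {M N} → Linear M → Linear N → Linear (λ p → M p ⊕ N p)
⊕-linear {M} {N} M-lin N-lin p = begin
  M p ⊕ N p
    ≈⟨ ⊕-cong (M-lin p) (N-lin p) ⟩
  lin (λ u → M (word u)) p ⊕ lin (λ u → N (word u)) p
    ≈⟨ lin-pointwise-⊕ (λ u → M (word u)) (λ u → N (word u)) p ⟨
  lin (λ u → M (word u) ⊕ N (word u)) p   ∎
  where open ≋-Reasoning

scale-linear : ∀ c {M} → Linear M → Linear (λ p → scale c (M p))
scale-linear c {M} M-lin p = begin
  scale c (M p)                        ≈⟨ scale-cong c (M-lin p) ⟩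
  scale c (lin (λ u → M (word u)) p)   ≈⟨ lin-pointwise-scale c (λ u → M (word u)) p ⟨
  lin (λ u → scale c (M (word u))) p   ∎
  where open ≋-Reasoning

pre≡lin : ∀ u p → pre u p ≡ lin (λ v → word (u ++ v)) p
pre≡lin u [] = refl
pre≡lin u ((c , v) ∷ p) = cong₂ _∷_ (cong (_, u ++ v) (sym (*-identityʳ c))) (pre≡lin u p)

pre-linear : ∀ u → Linear (pre u)
pre-linear u = linear-resp-≋ (λ p → ≋-reflexive (pre≡lin u p)) (lin-linear (λ v → word (u ++ v)))

scale-scale : ∀ c d p → scale c (scale d p) ≡ scale (c * d) p
scale-scale c d [] = refl
scale-scale c d ((e , u) ∷ p) = cong₂ _∷_ (cong (_, u) (sym (*-assoc c d e))) (scale-scale c d p)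

bilin≡lin-lin : ∀ f p q → bilin f p q ≡ lin (λ u → lin (f u) q) p
bilin≡lin-lin f p q = concatMap-cong (λ { (c , u) → sym (scale-lin c u) }) p
  where
  scale-lin : ∀ c u → scale c (lin (f u) q) ≡ concatMap (λ { (d , v) → scale (c * d) (f u v) }) q
  scale-lin c u = trans (map-concatMap _ _ q) (concatMap-cong (λ { (d , v) → scale-scale c d (f u v) }) q)

bilin-linearˡ : ∀ f q → Linear (λ p → bilin f p q)
bilin-linearˡ f q = linear-resp-≋ (λ p → ≋-reflexive (bilin≡lin-lin f p q)) (lin-linear (λ u → lin (f u) q))

·-linearˡ : ∀ q → Linear (_· q)
·-linearˡ = bilin-linearˡ (λ u v → word (u ++ v))

word-· : ∀ u r → word u · r ≋ pre u r
word-· u r = begin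
  word u · r                                           ≡⟨ bilin≡lin-lin (λ u′ v → word (u′ ++ v)) (word u) r ⟩
  lin (λ u′ → lin (λ v → word (u′ ++ v)) r) (word u)   ≈⟨ lin-word (λ u′ → lin (λ v → word (u′ ++ v)) r) u ⟩
  lin (λ v → word (u ++ v)) r                          ≡⟨ pre≡lin u r ⟨
  pre u r                                              ∎
  where open ≋-Reasoning

infixr 7 _◁_

_◁_ : Letter → H → H
a ◁ p = pre (a ∷ []) p

◁-linear : ∀ a → Linear (a ◁_)
◁-linear a = pre-linear (a ∷ [])

◁-cong : ∀ a {p q} → p ≋ q → a ◁ p ≋ a ◁ q
◁-cong a = linear-cong (◁-linear a)

◁-⊕ : ∀ a p q → a ◁ (p ⊕ q) ≡ a ◁ p ⊕ a ◁ q
◁-⊕ a = map-++ _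

◁-scale : ∀ a c p → a ◁ scale c p ≡ scale c (a ◁ p)
◁-scale a c [] = refl
◁-scale a c ((d , u) ∷ p) = cong ((c * d , a ∷ u) ∷_) (◁-scale a c p)

φ-linear : Linear φ
φ-linear = lin-linear φ-word

φ-cong : ∀ {p q} → p ≋ q → φ p ≋ φ q
φ-cong = linear-cong φ-linear

φ-word-x : ∀ v → φ-word (x ∷ v) ≋ x ◁ φ-word v ⊕ y ◁ φ-word v
φ-word-x v = begin
  (word (x ∷ []) ⊕ word (y ∷ [])) · φ-word v
    ≈⟨ linear-⊕ (·-linearˡ (φ-word v)) (word (x ∷ [])) (word (y ∷ [])) ⟩
  word (x ∷ []) · φ-word v ⊕ word (y ∷ []) · φ-word v
    ≈⟨ ⊕-cong (word-· (x ∷ []) (φ-word v)) (word-· (y ∷ []) (φ-word v)) ⟩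
  x ◁ φ-word v ⊕ y ◁ φ-word v   ∎
  where open ≋-Reasoning

φ-word-y : ∀ v → φ-word (y ∷ v) ≋ neg (y ◁ φ-word v)
φ-word-y v = begin
  neg (word (y ∷ [])) · φ-word v   ≈⟨ linear-scale (·-linearˡ (φ-word v)) (- 1ℚ) (word (y ∷ [])) ⟩
  neg (word (y ∷ []) · φ-word v)   ≈⟨ scale-cong (- 1ℚ) (word-· (y ∷ []) (φ-word v)) ⟩
  neg (y ◁ φ-word v)               ∎
  where open ≋-Reasoning

φ-x◁ : ∀ r → φ (x ◁ r) ≋ x ◁ φ r ⊕ y ◁ φ r
φ-x◁ = linear-unique (∘-linear φ-linear (◁-linear x))
  (⊕-linear (∘-linear (◁-linear x) φ-linear) (∘-linear (◁-linear y) φ-linear))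
  λ v → begin
    φ (word (x ∷ v))                  ≈⟨ lin-word φ-word (x ∷ v) ⟩
    φ-word (x ∷ v)                    ≈⟨ φ-word-x v ⟩
    x ◁ φ-word v ⊕ y ◁ φ-word v       ≈⟨ ⊕-cong (◁-cong x (lin-word φ-word v)) (◁-cong y (lin-word φ-word v)) ⟨
    x ◁ φ (word v) ⊕ y ◁ φ (word v)   ∎
  where open ≋-Reasoning

φ-y◁ : ∀ r → φ (y ◁ r) ≋ neg (y ◁ φ r)
φ-y◁ = linear-unique (∘-linear φ-linear (◁-linear y)) (scale-linear (- 1ℚ) (∘-linear (◁-linear y) φ-linear))
  λ v → begin
    φ (word (y ∷ v))       ≈⟨ lin-word φ-word (y ∷ v) ⟩
    φ-word (y ∷ v)         ≈⟨ φ-word-y v ⟩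
    neg (y ◁ φ-word v)     ≈⟨ scale-cong (- 1ℚ) (◁-cong y (lin-word φ-word v)) ⟨
    neg (y ◁ φ (word v))   ∎
  where open ≋-Reasoning

φ-z◁ : ∀ r → φ (x ◁ r ⊕ y ◁ r) ≋ x ◁ φ r
φ-z◁ r = begin
  φ (x ◁ r ⊕ y ◁ r)                   ≈⟨ linear-⊕ φ-linear (x ◁ r) (y ◁ r) ⟩
  φ (x ◁ r) ⊕ φ (y ◁ r)               ≈⟨ ⊕-cong (φ-x◁ r) (φ-y◁ r) ⟩
  x ◁ φ r ⊕ y ◁ φ r ⊕ neg (y ◁ φ r)   ≈⟨ ⊕-⊖-cancelʳ (x ◁ φ r) (y ◁ φ r) ⟩
  x ◁ φ r                             ∎
  where open ≋-Reasoning

φ-φ-word : ∀ u → φ (φ-word u) ≋ word u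
φ-φ-word [] = lin-word φ-word []
φ-φ-word (x ∷ v) = begin
  φ (φ-word (x ∷ v))                ≈⟨ φ-cong (φ-word-x v) ⟩
  φ (x ◁ φ-word v ⊕ y ◁ φ-word v)   ≈⟨ φ-z◁ (φ-word v) ⟩
  x ◁ φ (φ-word v)                  ≈⟨ ◁-cong x (φ-φ-word v) ⟩
  word (x ∷ v)                      ∎
  where open ≋-Reasoning
φ-φ-word (y ∷ v) = begin
  φ (φ-word (y ∷ v))             ≈⟨ φ-cong (φ-word-y v) ⟩
  φ (neg (y ◁ φ-word v))         ≈⟨ linear-scale φ-linear (- 1ℚ) (y ◁ φ-word v) ⟩
  neg (φ (y ◁ φ-word v))         ≈⟨ scale-cong (- 1ℚ) (φ-y◁ (φ-word v)) ⟩
  neg (neg (y ◁ φ (φ-word v)))   ≈⟨ neg-involutive (y ◁ φ (φ-word v)) ⟩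
  y ◁ φ (φ-word v)               ≈⟨ ◁-cong y (φ-φ-word v) ⟩
  word (y ∷ v)                   ∎
  where open ≋-Reasoning

ψ : H → H
ψ p = φ (p ✱ φ 𝕪)

ψ-linear : Linear ψ
ψ-linear = ∘-linear φ-linear (bilin-linearˡ harm-word (φ 𝕪))

ψ-cong : ∀ {p q} → p ≋ q → ψ p ≋ ψ q
ψ-cong = linear-cong ψ-linear

_✱y : Word → H
u ✱y = harm-word u (y ∷ [])

ψ-word : ∀ u → ψ (word u) ≋ neg (φ (u ✱y))
ψ-word u = begin
  φ (word u ✱ φ 𝕪)
    ≡⟨ cong φ (bilin≡lin-lin harm-word (word u) (φ 𝕪)) ⟩
  φ (lin (λ u′ → lin (harm-word u′) (φ 𝕪)) (word u))
    ≈⟨ φ-cong (lin-word (λ u′ → lin (harm-word u′) (φ 𝕪)) u) ⟩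
  φ (neg (u ✱y) ++ [])
    ≡⟨ cong φ (++-identityʳ (neg (u ✱y))) ⟩
  φ (neg (u ✱y))
    ≈⟨ linear-scale φ-linear (- 1ℚ) (u ✱y) ⟩
  neg (φ (u ✱y))   ∎
  where open ≋-Reasoning

harm-word-[] : ∀ v → harm-word v [] ≡ word v
harm-word-[] [] = refl
harm-word-[] (x ∷ v) = cong (x ◁_) (harm-word-[] v)
harm-word-[] (y ∷ v) = refl

yu✱y : ∀ u → (y ∷ u) ✱y ≋ y ◁ (u ✱y ⊕ (x ◁ word u ⊕ y ◁ word u))
yu✱y u = begin
  (y ◁ (u ✱y) ⊕ y ◁ y ◁ word u) ⊕ pre (y ∷ x ∷ []) (harm-word u [])
    ≡⟨ cong (λ t → (y ◁ (u ✱y) ⊕ y ◁ y ◁ word u) ⊕ pre (y ∷ x ∷ []) t) (harm-word-[] u) ⟩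
  (y ◁ (u ✱y) ⊕ y ◁ y ◁ word u) ⊕ y ◁ x ◁ word u
    ≡⟨ ⊕-assoc (y ◁ (u ✱y)) (y ◁ y ◁ word u) (y ◁ x ◁ word u) ⟩
  y ◁ (u ✱y) ⊕ (y ◁ y ◁ word u ⊕ y ◁ x ◁ word u)
    ≈⟨ ⊕-cong ≋-refl (⊕-comm (y ◁ y ◁ word u) (y ◁ x ◁ word u)) ⟩
  y ◁ (u ✱y) ⊕ (y ◁ x ◁ word u ⊕ y ◁ y ◁ word u)
    ≡⟨ cong (y ◁ (u ✱y) ⊕_) (◁-⊕ y (x ◁ word u) (y ◁ word u)) ⟨
  y ◁ (u ✱y) ⊕ y ◁ (x ◁ word u ⊕ y ◁ word u)
    ≡⟨ ◁-⊕ y (u ✱y) (x ◁ word u ⊕ y ◁ word u) ⟨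
  y ◁ (u ✱y ⊕ (x ◁ word u ⊕ y ◁ word u))   ∎
  where open ≋-Reasoning

ψ-x◁ : ∀ q → ψ (x ◁ q) ≋ x ◁ ψ q ⊕ y ◁ ψ q
ψ-x◁ = linear-unique (∘-linear ψ-linear (◁-linear x))
  (⊕-linear (∘-linear (◁-linear x) ψ-linear) (∘-linear (◁-linear y) ψ-linear))
  λ v → begin
    ψ (word (x ∷ v))
      ≈⟨ ψ-word (x ∷ v) ⟩
    neg (φ (x ◁ (v ✱y)))
      ≈⟨ scale-cong (- 1ℚ) (φ-x◁ (v ✱y)) ⟩
    neg (x ◁ φ (v ✱y) ⊕ y ◁ φ (v ✱y))
      ≡⟨ scale-⊕ (- 1ℚ) (x ◁ φ (v ✱y)) (y ◁ φ (v ✱y)) ⟩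
    neg (x ◁ φ (v ✱y)) ⊕ neg (y ◁ φ (v ✱y))
      ≡⟨ cong₂ _⊕_ (◁-scale x (- 1ℚ) (φ (v ✱y))) (◁-scale y (- 1ℚ) (φ (v ✱y))) ⟨
    x ◁ neg (φ (v ✱y)) ⊕ y ◁ neg (φ (v ✱y))
      ≈⟨ ⊕-cong (◁-cong x (ψ-word v)) (◁-cong y (ψ-word v)) ⟨
    x ◁ ψ (word v) ⊕ y ◁ ψ (word v)   ∎
  where open ≋-Reasoning

ψ-y◁ : ∀ q → ψ (y ◁ q) ≋ neg (y ◁ ψ q) ⊕ y ◁ x ◁ φ q
ψ-y◁ = linear-unique (∘-linear ψ-linear (◁-linear y))
  (⊕-linear (scale-linear (- 1ℚ) (∘-linear (◁-linear y) ψ-linear))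
            (∘-linear (◁-linear y) (∘-linear (◁-linear x) φ-linear)))
  λ u → begin
    ψ (word (y ∷ u))
      ≈⟨ ψ-word (y ∷ u) ⟩
    neg (φ ((y ∷ u) ✱y))
      ≈⟨ scale-cong (- 1ℚ) (φ-cong (yu✱y u)) ⟩
    neg (φ (y ◁ (u ✱y ⊕ (x ◁ word u ⊕ y ◁ word u))))
      ≈⟨ scale-cong (- 1ℚ) (φ-y◁ (u ✱y ⊕ (x ◁ word u ⊕ y ◁ word u))) ⟩
    neg (neg (y ◁ φ (u ✱y ⊕ (x ◁ word u ⊕ y ◁ word u))))
      ≈⟨ neg-involutive _ ⟩
    y ◁ φ (u ✱y ⊕ (x ◁ word u ⊕ y ◁ word u))
      ≈⟨ ◁-cong y (linear-⊕ φ-linear (u ✱y) _) ⟩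
    y ◁ (φ (u ✱y) ⊕ φ (x ◁ word u ⊕ y ◁ word u))
      ≈⟨ ◁-cong y (⊕-cong ≋-refl (φ-z◁ (word u))) ⟩
    y ◁ (φ (u ✱y) ⊕ x ◁ φ (word u))
      ≡⟨ ◁-⊕ y (φ (u ✱y)) (x ◁ φ (word u)) ⟩
    y ◁ φ (u ✱y) ⊕ y ◁ x ◁ φ (word u)
      ≈⟨ ⊕-cong (neg-involutive (y ◁ φ (u ✱y))) ≋-refl ⟨
    neg (neg (y ◁ φ (u ✱y))) ⊕ y ◁ x ◁ φ (word u)
      ≡⟨ cong (λ t → neg t ⊕ y ◁ x ◁ φ (word u)) (◁-scale y (- 1ℚ) (φ (u ✱y))) ⟨
    neg (y ◁ neg (φ (u ✱y))) ⊕ y ◁ x ◁ φ (word u)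
      ≈⟨ ⊕-cong (scale-cong (- 1ℚ) (◁-cong y (ψ-word u))) ≋-refl ⟨
    neg (y ◁ ψ (word u)) ⊕ y ◁ x ◁ φ (word u)   ∎
  where open ≋-Reasoning

ψ-φ-word : ∀ u → ψ (φ-word u) ≋ ∂₁-word u ⊕ word (u ++ y ∷ [])
ψ-φ-word [] = begin
  ψ (word [])                   ≈⟨ ψ-word [] ⟩
  neg (φ (y ◁ word []))         ≈⟨ scale-cong (- 1ℚ) (φ-y◁ (word [])) ⟩
  neg (neg (y ◁ φ (word [])))   ≈⟨ neg-involutive (y ◁ φ (word [])) ⟩
  y ◁ φ (word [])               ≈⟨ ◁-cong y (lin-word φ-word []) ⟩
  word (y ∷ [])                 ∎
  where open ≋-Reasoning
ψ-φ-word (x ∷ u) = begin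
  ψ (φ-word (x ∷ u))
    ≈⟨ ψ-cong (φ-word-x u) ⟩
  ψ (x ◁ A ⊕ y ◁ A)
    ≈⟨ linear-⊕ ψ-linear (x ◁ A) (y ◁ A) ⟩
  ψ (x ◁ A) ⊕ ψ (y ◁ A)
    ≈⟨ ⊕-cong (ψ-x◁ A) (ψ-y◁ A) ⟩
  (x ◁ ψ A ⊕ y ◁ ψ A) ⊕ (neg (y ◁ ψ A) ⊕ y ◁ x ◁ φ A)
    ≡⟨ ⊕-assoc (x ◁ ψ A ⊕ y ◁ ψ A) (neg (y ◁ ψ A)) (y ◁ x ◁ φ A) ⟨
  x ◁ ψ A ⊕ y ◁ ψ A ⊖ y ◁ ψ A ⊕ y ◁ x ◁ φ A
    ≈⟨ ⊕-cong (⊕-⊖-cancelʳ (x ◁ ψ A) (y ◁ ψ A)) ≋-refl ⟩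
  x ◁ ψ A ⊕ y ◁ x ◁ φ A
    ≈⟨ ⊕-cong (◁-cong x (ψ-φ-word u)) (◁-cong y (◁-cong x (φ-φ-word u))) ⟩
  x ◁ (∂₁-word u ⊕ word (u ++ y ∷ [])) ⊕ y ◁ x ◁ word u
    ≡⟨ cong (_⊕ y ◁ x ◁ word u) (◁-⊕ x (∂₁-word u) (word (u ++ y ∷ []))) ⟩
  x ◁ ∂₁-word u ⊕ word (x ∷ u ++ y ∷ []) ⊕ word (y ∷ x ∷ u)
    ≈⟨ ⊕-rotate (x ◁ ∂₁-word u) (word (x ∷ u ++ y ∷ [])) (word (y ∷ x ∷ u)) ⟩
  word (y ∷ x ∷ u) ⊕ x ◁ ∂₁-word u ⊕ word (x ∷ u ++ y ∷ [])
    ≈⟨ ⊕-cong (⊕-cong (word-· (y ∷ x ∷ []) (word u)) (≋-refl {x ◁ ∂₁-word u})) (≋-refl {word (x ∷ u ++ y ∷ [])}) ⟨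
  ∂₁-word (x ∷ u) ⊕ word (x ∷ u ++ y ∷ [])   ∎
  where
  open ≋-Reasoning
  A = φ-word u
ψ-φ-word (y ∷ u) = begin
  ψ (φ-word (y ∷ u))
    ≈⟨ ψ-cong (φ-word-y u) ⟩
  ψ (neg (y ◁ A))
    ≈⟨ linear-scale ψ-linear (- 1ℚ) (y ◁ A) ⟩
  neg (ψ (y ◁ A))
    ≈⟨ scale-cong (- 1ℚ) (ψ-y◁ A) ⟩
  neg (neg (y ◁ ψ A) ⊕ y ◁ x ◁ φ A)
    ≡⟨ scale-⊕ (- 1ℚ) (neg (y ◁ ψ A)) (y ◁ x ◁ φ A) ⟩
  neg (neg (y ◁ ψ A)) ⊕ neg (y ◁ x ◁ φ A)
    ≈⟨ ⊕-cong (neg-involutive (y ◁ ψ A)) (scale-cong (- 1ℚ) (◁-cong y (◁-cong x (φ-φ-word u)))) ⟩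
  y ◁ ψ A ⊕ neg (word (y ∷ x ∷ u))
    ≈⟨ ⊕-cong (◁-cong y (ψ-φ-word u)) ≋-refl ⟩
  y ◁ (∂₁-word u ⊕ word (u ++ y ∷ [])) ⊕ neg (word (y ∷ x ∷ u))
    ≡⟨ cong (_⊕ neg (word (y ∷ x ∷ u))) (◁-⊕ y (∂₁-word u) (word (u ++ y ∷ []))) ⟩
  y ◁ ∂₁-word u ⊕ word (y ∷ u ++ y ∷ []) ⊕ neg (word (y ∷ x ∷ u))
    ≈⟨ ⊕-rotate (y ◁ ∂₁-word u) (word (y ∷ u ++ y ∷ [])) (neg (word (y ∷ x ∷ u))) ⟩
  neg (word (y ∷ x ∷ u)) ⊕ y ◁ ∂₁-word u ⊕ word (y ∷ u ++ y ∷ [])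
    ≈⟨ ⊕-cong (⊕-cong yx·u (≋-refl {y ◁ ∂₁-word u})) (≋-refl {word (y ∷ u ++ y ∷ [])}) ⟨
  ∂₁-word (y ∷ u) ⊕ word (y ∷ u ++ y ∷ [])   ∎
  where
  open ≋-Reasoning
  A = φ-word u
  yx·u : neg (word (y ∷ x ∷ [])) · word u ≋ neg (word (y ∷ x ∷ u))
  yx·u = ≋-trans (linear-scale (·-linearˡ (word u)) (- 1ℚ) (word (y ∷ x ∷ [])))
                 (scale-cong (- 1ℚ) (word-· (y ∷ x ∷ []) (word u)))

lemma2p4 : (w : H) → ∂₁ w ≈ (w ◇ 𝕪) ⊖ (w · 𝕪)
lemma2p4 w = at (linear-unique ∂₁-linear rhs-linear on-words w)
  where
  open ≋-Reasoning
  ∂₁-linear : Linear ∂₁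
  ∂₁-linear = lin-linear ∂₁-word
  rhs-linear : Linear (λ p → (p ◇ 𝕪) ⊖ (p · 𝕪))
  rhs-linear = ⊕-linear (∘-linear ψ-linear φ-linear) (scale-linear (- 1ℚ) (·-linearˡ 𝕪))
  on-words : ∀ u → ∂₁ (word u) ≋ (word u ◇ 𝕪) ⊖ (word u · 𝕪)
  on-words u = begin
    ∂₁ (word u)
      ≈⟨ lin-word ∂₁-word u ⟩
    ∂₁-word u
      ≈⟨ ⊕-⊖-cancelʳ (∂₁-word u) (word (u ++ y ∷ [])) ⟨
    ∂₁-word u ⊕ word (u ++ y ∷ []) ⊖ word (u ++ y ∷ [])
      ≈⟨ ⊕-cong (ψ-φ-word u) (scale-cong (- 1ℚ) (word-· u 𝕪)) ⟨
    ψ (φ-word u) ⊖ word u · 𝕪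
      ≈⟨ ⊕-cong (ψ-cong (lin-word φ-word u)) (≋-refl {neg (word u · 𝕪)}) ⟨
    ψ (φ (word u)) ⊖ word u · 𝕪   ∎
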